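{- Let $\Delta$ be a positive integer and let $G$ be a nice graph of maximum degree at most $\Delta$. Then $P^1(G)\leq\Delta^2-1$.
   Context: Graphs are finite, simple and undirected; $\mathbb{N}_0=\{0,1,2,\dots\}$. A graph is nice if it has no connected component of order two. A function $\rho:V(G)\to\mathbb{N}_0$ is a proper pushing scheme of $G$ if the function $\sigma(u)=(1+\rho(u))d_G(u)+\sum_{v\in N_G(u)}\rho(v)$ satisfies $\sigma(u)\neq\sigma(v)$ for every edge $uv$ of $G$. For a nice graph $G$, $P^1(G)=\min\{\max_{u\in V(G)}\rho(u): \rho \text{ a proper pushing scheme of } G\}$. -}

module Defs where

open import Data.Nat using (ℕ; zero; suc; _+_; _*_; _∸_; _≤_)
open import Data.Bool using (Bool; true; false; if_then_else_)
open import Data.Fin using (Fin)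
open import Data.List using (List; map; allFin)
open import Data.Nat.ListAction using (sum)
open import Data.Product using (Σ; _×_; _,_)
open import Data.Sum using (_⊎_)
open import Relation.Binary.PropositionalEquality using (_≡_; _≢_)
open import Relation.Nullary using (¬_)

record Graph (n : ℕ) : Set where
  field
    adj    : Fin n → Fin n → Bool
    sym    : ∀ u v → adj u v ≡ adj v u
    irrefl : ∀ u → adj u u ≡ false
open Graph public

module _ {n : ℕ} (G : Graph n) where

  deg : Fin n → ℕ
  deg u = sum (map (λ v → if adj G u v then 1 else 0) (allFin n))

  nbrSum : (Fin n → ℕ) → Fin n → ℕ
  nbrSum f u = sum (map (λ v → if adj G u v then f v else 0) (allFin n))

  data Reach : Fin n → Fin n → Set where
    here : ∀ {u} → Reach u u
    step : ∀ {u v w} → adj G u v ≡ true → Reach v w → Reach u w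

  HasComponentOfOrderTwo : Set
  HasComponentOfOrderTwo =
    Σ (Fin n) λ u → Σ (Fin n) λ v →
      u ≢ v × Reach u v × (∀ w → Reach u w → (w ≡ u) ⊎ (w ≡ v))

  Nice : Set
  Nice = ¬ HasComponentOfOrderTwo

  MaxDegreeAtMost : ℕ → Set
  MaxDegreeAtMost Δ = ∀ u → deg u ≤ Δ

  σ : (Fin n → ℕ) → Fin n → ℕ
  σ ρ u = (1 + ρ u) * deg u + nbrSum ρ u

  ProperPushingScheme : (Fin n → ℕ) → Set
  ProperPushingScheme ρ = ∀ u v → adj G u v ≡ true → σ ρ u ≢ σ ρ v

  -- P¹(G) ≤ k  (P¹ is a minimum over proper pushing schemes of max ρ,
  -- so this is: some proper pushing scheme has all values ≤ k)
  P¹≤ : ℕ → Set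
  P¹≤ k = Σ (Fin n → ℕ) λ ρ → ProperPushingScheme ρ × (∀ u → ρ u ≤ k)

{-# OPTIONS --safe #-}
-- σ ρ u is affine in each value ρ z, with slope influence u z. Values in
-- {0, …, Δ² − 1} are fixed greedily, keeping the invariant that every edge on which the
-- still-unfixed vertices have balanced influence is proper; at the start this excludes only an edge
-- between two vertices of degree one, which niceness rules out. Fixing z endangers only the edges
-- unbalanced at z; oriented as paths z ~ u ~ y, each forbids at most one value, and there are at most
-- Σ_{u ~ z} d(u) ≤ Δ² of them: one too many. So a vertex w is fixed together with a neighbour x.
-- The paths from w that x unbalances stay harmless while x is unfixed, which leaves w a free value;
-- x is fixed next. If x could be blocked, its count is saturated, forcing Δ ≥ 2 and leaving w three
-- free values t₁ < t₂ < t₃, each turning the values forbidden for x into a permutation of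
-- {0, …, Δ² − 1}. A forbidden value of x depends affinely on the value t of w, so the equal sums of
-- squares of the three permutations force agreement at t₁ and t₃, which fails for the edge wx itself.
module Submission where

open import Defs
open import Data.Nat using (ℕ; _*_; _∸_; _≤_)

open import Data.Nat
open import Data.Nat.Properties
open import Algebra.Properties.Semiring.Sum +-*-semiring
  using (sum-syntax; sum-cong-≗; ∑-distrib-+; *-distribˡ-sum; *-distribʳ-sum)
  renaming (sum to ∑)
open import Algebra.Properties.CommutativeSemigroup +-commutativeSemigroup
  using (xy∙z≈xz∙y; xy∙z≈zy∙x)
open import Data.Bool using (true; false; if_then_else_)
import Data.Bool.Properties as Bool
open import Data.Empty using (⊥; ⊥-elim)
open import Data.Fin using (Fin; zero; suc)
open import Data.Fin.Properties using (any?) renaming (_≟_ to _≟ᶠ_)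
open import Data.List
  using (List; []; _∷_; _++_; map; length; filter; allFin; tabulate; downFrom; cartesianProduct)
open import Data.List.Properties using (map-++; map-∘; length-map; length-downFrom)
open import Data.List.Membership.Propositional using (_∈_; _∉_)
open import Data.List.Membership.Propositional.Properties
  using (∈-∃++; ∈-map⁺; ∈-filter⁺; ∈-filter⁻; ∈-cartesianProduct⁺; ∈-allFin; ∈-downFrom⁻)
open import Data.List.Membership.DecPropositional _≟_ using (_∈?_)
open import Data.List.Relation.Binary.Permutation.Propositional using (_↭_; prep; ↭-refl; ↭-trans)
open import Data.List.Relation.Binary.Permutation.Propositional.Properties
  using (shift; ↭-length; map⁺; ∈-resp-↭)
open import Data.List.Relation.Binary.Subset.Propositional using (_⊆_)
open import Data.List.Relation.Unary.All as All using (All; []; _∷_; all?)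
open import Data.List.Relation.Unary.All.Properties using (anti-mono)
open import Data.List.Relation.Unary.Any using (here; there)
open import Data.Nat.ListAction using (sum)
open import Data.Nat.ListAction.Properties using (sum-++; sum-↭)
open import Data.Nat.Tactic.RingSolver using (solve-∀)
open import Data.Product using (∃; _×_; _,_; proj₂)
open import Data.Sum using (_⊎_; inj₁; inj₂)
open import Data.Vec.Functional using (updateAt)
open import Data.Vec.Functional.Properties using (updateAt-updates; updateAt-minimal)
open import Function using (_∘_; const)
open import Relation.Binary.Definitions using (tri<; tri≈; tri>)
open import Relation.Binary.PropositionalEquality hiding (sym)
import Relation.Binary.PropositionalEquality as ≡
open import Relation.Nullary using (¬_; Dec; yes; no; does; ¬?; _×-dec_; contradiction)
open import Relation.Nullary.Decidable using (decidable-stable)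
open import Relation.Unary using (Decidable)

𝟙 : ∀ {P : Set} → Dec P → ℕ
𝟙 P? = if does P? then 1 else 0

𝟙-yes : ∀ {P : Set} (P? : Dec P) → P → 𝟙 P? ≡ 1
𝟙-yes (yes _) _ = refl
𝟙-yes (no ¬p) p = contradiction p ¬p

𝟙-no : ∀ {P : Set} (P? : Dec P) → ¬ P → 𝟙 P? ≡ 0
𝟙-no (yes p) ¬p = contradiction p ¬p
𝟙-no (no _)  _  = refl

𝟙-pos : ∀ {P : Set} (P? : Dec P) → 0 < 𝟙 P? → P
𝟙-pos (yes p) _ = p

𝟙≤1 : ∀ {P : Set} (P? : Dec P) → 𝟙 P? ≤ 1
𝟙≤1 (yes _) = ≤-refl
𝟙≤1 (no _)  = z≤n

𝟙-× : ∀ {P Q : Set} (P? : Dec P) (Q? : Dec Q) → 𝟙 (P? ×-dec Q?) ≡ 𝟙 P? * 𝟙 Q?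
𝟙-× (yes _) (yes _) = refl
𝟙-× (yes _) (no _)  = refl
𝟙-× (no _)  _       = refl

𝟙-mono : ∀ {P Q : Set} (P? : Dec P) (Q? : Dec Q) → (P → Q) → 𝟙 P? ≤ 𝟙 Q?
𝟙-mono (yes p) Q? P⇒Q = ≤-reflexive (≡.sym (𝟙-yes Q? (P⇒Q p)))
𝟙-mono (no _)  _  _   = z≤n

𝟙-disjoint : ∀ {P Q R : Set} (P? : Dec P) (Q? : Dec Q) (R? : Dec R) →
           (P → ¬ Q) → (P → R) → (Q → R) → 𝟙 P? + 𝟙 Q? ≤ 𝟙 R?
𝟙-disjoint (yes p) (yes q) _  P⇒¬Q _   _   = contradiction q (P⇒¬Q p)
𝟙-disjoint (yes p) (no _)  R? _    P⇒R _   = ≤-reflexive (≡.sym (𝟙-yes R? (P⇒R p)))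
𝟙-disjoint (no _)  Q?      R? _    _   Q⇒R = 𝟙-mono Q? R? Q⇒R

∑-mono-≤ : ∀ {n} {f g : Fin n → ℕ} → (∀ i → f i ≤ g i) → ∑ f ≤ ∑ g
∑-mono-≤ {zero}  _   = z≤n
∑-mono-≤ {suc n} f≤g = +-mono-≤ (f≤g zero) (∑-mono-≤ (f≤g ∘ suc))

∑-tight : ∀ {n} {f g : Fin n → ℕ} → (∀ i → f i ≤ g i) → ∑ g ≤ ∑ f → ∀ i → f i ≡ g i
∑-tight {suc n} {f} {g} f≤g g≤f zero = ≤-antisym (f≤g zero)
  (+-cancelʳ-≤ _ _ _ (≤-trans g≤f (+-monoʳ-≤ (f zero) (∑-mono-≤ (f≤g ∘ suc)))))
∑-tight {suc n} {f} {g} f≤g g≤f (suc i) = ∑-tight (f≤g ∘ suc)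
  (+-cancelˡ-≤ (g zero) _ _ (≤-trans g≤f (+-monoˡ-≤ _ (f≤g zero)))) i

≤-∑ : ∀ {n} (f : Fin n → ℕ) i → f i ≤ ∑ f
≤-∑ f zero    = m≤m+n _ _
≤-∑ f (suc i) = ≤-trans (≤-∑ (f ∘ suc) i) (m≤n+m _ _)

≤-∑-pair : ∀ {n} (f : Fin n → ℕ) {i j} → i ≢ j → f i + f j ≤ ∑ f
≤-∑-pair f {zero}  {zero}  i≢j = contradiction refl i≢j
≤-∑-pair f {zero}  {suc j} _   = +-monoʳ-≤ (f zero) (≤-∑ (f ∘ suc) j)
≤-∑-pair f {suc i} {zero}  _   =
  subst (_≤ ∑ f) (+-comm (f zero) (f (suc i))) (+-monoʳ-≤ (f zero) (≤-∑ (f ∘ suc) i))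
≤-∑-pair f {suc i} {suc j} i≢j = ≤-trans (≤-∑-pair (f ∘ suc) (i≢j ∘ cong suc)) (m≤n+m _ _)

1≤∑𝟙 : ∀ {n} {P : Fin n → Set} (P? : Decidable P) i → P i → 1 ≤ ∑[ j < n ] 𝟙 (P? j)
1≤∑𝟙 P? i p = ≤-trans (≤-reflexive (≡.sym (𝟙-yes (P? i) p))) (≤-∑ (𝟙 ∘ P?) i)

∃-positive-term : ∀ {n} (f : Fin n → ℕ) → 0 < ∑ f → ∃ λ i → 0 < f i
∃-positive-term {suc n} f pos with f zero in f0
... | suc _ = zero , subst (0 <_) (≡.sym f0) z<s
... | zero  = let i , fi>0 = ∃-positive-term (f ∘ suc) pos in suc i , fi>0

∃-other-positive-term : ∀ {n} (f : Fin n → ℕ) z → f z < ∑ f → ∃ λ i → i ≢ z × 0 < f i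
∃-other-positive-term {suc n} f zero lt =
  let i , fi>0 = ∃-positive-term (f ∘ suc) (+-cancelˡ-< (f zero) 0 _ (subst (_< ∑ f) (≡.sym (+-identityʳ _)) lt))
  in suc i , (λ ()) , fi>0
∃-other-positive-term {suc n} f (suc z) lt with f zero in f0
... | suc _ = zero , (λ ()) , subst (0 <_) (≡.sym f0) z<s
... | zero  = let i , i≢z , fi>0 = ∃-other-positive-term (f ∘ suc) z lt
              in suc i , i≢z ∘ Data.Fin.Properties.suc-injective , fi>0

sum-map-tabulate : ∀ {A : Set} {n} (f : Fin n → A) (g : A → ℕ) →
                   sum (map g (tabulate f)) ≡ ∑[ i < n ] g (f i)
sum-map-tabulate {n = zero}  f g = refl
sum-map-tabulate {n = suc n} f g = cong (g (f zero) +_) (sum-map-tabulate (f ∘ suc) g)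

sum-map-allFin : ∀ {n} (g : Fin n → ℕ) → sum (map g (allFin n)) ≡ ∑ g
sum-map-allFin g = sum-map-tabulate (λ i → i) g

∑-updateAt : ∀ {n} (h : Fin n → ℕ → ℕ) (ρ : Fin n → ℕ) z t →
             ∑[ v < n ] h v (updateAt ρ z (const t) v) + h z (ρ z) ≡ ∑[ v < n ] h v (ρ v) + h z t
∑-updateAt h ρ zero    t = xy∙z≈zy∙x (h zero t) _ (h zero (ρ zero))
∑-updateAt h ρ (suc z) t = begin
  h zero (ρ zero) + ∑[ v < _ ] h (suc v) (updateAt (ρ ∘ suc) z (const t) v) + h (suc z) (ρ (suc z))
    ≡⟨ +-assoc (h zero (ρ zero)) _ _ ⟩
  h zero (ρ zero) + (∑[ v < _ ] h (suc v) (updateAt (ρ ∘ suc) z (const t) v) + h (suc z) (ρ (suc z)))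
    ≡⟨ cong (h zero (ρ zero) +_) (∑-updateAt (h ∘ suc) (ρ ∘ suc) z t) ⟩
  h zero (ρ zero) + (∑[ v < _ ] h (suc v) (ρ (suc v)) + h (suc z) t)
    ≡⟨ +-assoc (h zero (ρ zero)) _ _ ⟨
  h zero (ρ zero) + ∑[ v < _ ] h (suc v) (ρ (suc v)) + h (suc z) t ∎
  where open ≡-Reasoning

module _ {A : Set} where

  sum-map-cong : ∀ {f g : A → ℕ} xs → (∀ {x} → x ∈ xs → f x ≡ g x) → sum (map f xs) ≡ sum (map g xs)
  sum-map-cong []       _   = refl
  sum-map-cong (x ∷ xs) f≡g = cong₂ _+_ (f≡g (here refl)) (sum-map-cong xs (f≡g ∘ there))

  sum-map-linear : ∀ a b (f g : A → ℕ) xs →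
                   sum (map (λ x → a * f x + b * g x) xs) ≡ a * sum (map f xs) + b * sum (map g xs)
  sum-map-linear a b f g []       = ≡.sym (cong₂ _+_ (*-zeroʳ a) (*-zeroʳ b))
  sum-map-linear a b f g (x ∷ xs) =
    trans (cong (a * f x + b * g x +_) (sum-map-linear a b f g xs)) (regroup a b (f x) (g x) _ _)
    where
    regroup : ∀ a b p q P Q → a * p + b * q + (a * P + b * Q) ≡ a * (p + P) + b * (q + Q)
    regroup = solve-∀

  sum-map≡0 : ∀ (f : A → ℕ) {xs x} → sum (map f xs) ≡ 0 → x ∈ xs → f x ≡ 0
  sum-map≡0 f {y ∷ _} eq (here refl) = m+n≡0⇒m≡0 (f y) eq
  sum-map≡0 f {y ∷ _} eq (there x∈)  = sum-map≡0 f (m+n≡0⇒n≡0 (f y) eq) x∈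

  length-filter : ∀ {P : A → Set} (P? : Decidable P) xs → length (filter P? xs) ≡ sum (map (𝟙 ∘ P?) xs)
  length-filter P? []       = refl
  length-filter P? (x ∷ xs) with P? x
  ... | yes _ = cong suc (length-filter P? xs)
  ... | no  _ = length-filter P? xs

sum-map-cartesianProduct : ∀ {A B : Set} (g : A × B → ℕ) xs ys →
  sum (map g (cartesianProduct xs ys)) ≡ sum (map (λ x → sum (map (λ y → g (x , y)) ys)) xs)
sum-map-cartesianProduct g []       ys = refl
sum-map-cartesianProduct g (x ∷ xs) ys = begin
  sum (map g (map (x ,_) ys ++ cartesianProduct xs ys))
    ≡⟨ cong sum (map-++ g (map (x ,_) ys) _) ⟩
  sum (map g (map (x ,_) ys) ++ map g (cartesianProduct xs ys))
    ≡⟨ sum-++ (map g (map (x ,_) ys)) _ ⟩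
  sum (map g (map (x ,_) ys)) + sum (map g (cartesianProduct xs ys))
    ≡⟨ cong₂ _+_ (cong sum (≡.sym (map-∘ ys))) (sum-map-cartesianProduct g xs ys) ⟩
  sum (map (λ y → g (x , y)) ys) + sum (map (λ x → sum (map (λ y → g (x , y)) ys)) xs) ∎
  where open ≡-Reasoning

allPairs : ∀ n → List (Fin n × Fin n)
allPairs n = cartesianProduct (allFin n) (allFin n)

∈-allPairs : ∀ {n} (u y : Fin n) → (u , y) ∈ allPairs n
∈-allPairs u y = ∈-cartesianProduct⁺ (∈-allFin u) (∈-allFin y)

length-filter-allPairs : ∀ {n} {P : Fin n × Fin n → Set} (P? : Decidable P) →
  length (filter P? (allPairs n)) ≡ ∑[ u < n ] ∑[ y < n ] 𝟙 (P? (u , y))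
length-filter-allPairs {n} P? = begin
  length (filter P? (allPairs n))          ≡⟨ length-filter P? (allPairs n) ⟩
  sum (map (𝟙 ∘ P?) (allPairs n))          ≡⟨ sum-map-cartesianProduct (𝟙 ∘ P?) (allFin n) (allFin n) ⟩
  sum (map row (allFin n))                 ≡⟨ sum-map-allFin row ⟩
  ∑[ u < n ] row u                         ≡⟨ sum-cong-≗ (λ u → sum-map-allFin (λ y → 𝟙 (P? (u , y)))) ⟩
  ∑[ u < n ] ∑[ y < n ] 𝟙 (P? (u , y))     ∎
  where
  row : Fin n → ℕ
  row u = sum (map (λ y → 𝟙 (P? (u , y))) (allFin n))
  open ≡-Reasoning

-- Lists covering an initial segment of ℕ

FreeBelow : ℕ → List ℕ → ℕ → Set
FreeBelow m xs t = t < m × t ∉ xs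

Covers : ℕ → List ℕ → Set
Covers m xs = ∀ {s} → s < m → s ∈ xs

covers-↭-downFrom : ∀ m {xs} → length xs ≤ m → Covers m xs → xs ↭ downFrom m
covers-↭-downFrom zero    {[]} _ _ = ↭-refl
covers-↭-downFrom (suc m) {xs} len cov with ys , zs , refl ← ∈-∃++ (cov ≤-refl) =
  ↭-trans (shift m ys zs) (prep m (covers-↭-downFrom m len′ cov′))
  where
  len′ : length (ys ++ zs) ≤ m
  len′ = s≤s⁻¹ (subst (_≤ suc m) (↭-length (shift m ys zs)) len)
  cov′ : Covers m (ys ++ zs)
  cov′ s<m with ∈-resp-↭ (shift m ys zs) (cov (m<n⇒m<1+n s<m))
  ... | here s≡m = contradiction s≡m (<⇒≢ s<m)
  ... | there s∈ = s∈

covers-or-misses : ∀ m xs → Covers m xs ⊎ ∃ (FreeBelow m xs)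
covers-or-misses m xs with anyUpTo? (λ s → ¬? (s ∈? xs)) m
... | yes miss = inj₂ miss
... | no ¬miss = inj₁ λ {s} s<m → decidable-stable (s ∈? xs) (λ s∉ → ¬miss (s , s<m , s∉))

∃-free : ∀ {m xs} → length xs < m → ∃ (FreeBelow m xs)
∃-free {m} {xs} len with covers-or-misses m xs
... | inj₂ miss = miss
... | inj₁ cov  = contradiction (trans (↭-length (covers-↭-downFrom m (<⇒≤ len) cov)) (length-downFrom m))
                                (<⇒≢ len)

sort₃ : ∀ (P : ℕ → Set) {a b c} → a ≢ b → b ≢ c → a ≢ c → P a → P b → P c →
        ∃ λ t₁ → ∃ λ t₂ → ∃ λ t₃ → t₁ < t₂ × t₂ < t₃ × P t₁ × P t₂ × P t₃
sort₃ P {a} {b} {c} a≢b b≢c a≢c pa pb pc with <-cmp a b | <-cmp b c | <-cmp a c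
... | tri≈ _ a≡b _ | _            | _            = contradiction a≡b a≢b
... | _            | tri≈ _ b≡c _ | _            = contradiction b≡c b≢c
... | _            | _            | tri≈ _ a≡c _ = contradiction a≡c a≢c
... | tri< a<b _ _ | tri< b<c _ _ | _            = a , b , c , a<b , b<c , pa , pb , pc
... | tri< a<b _ _ | tri> _ _ c<b | tri< a<c _ _ = a , c , b , a<c , c<b , pa , pc , pb
... | tri< a<b _ _ | tri> _ _ c<b | tri> _ _ c<a = c , a , b , c<a , a<b , pc , pa , pb
... | tri> _ _ b<a | tri< b<c _ _ | tri< a<c _ _ = b , a , c , b<a , a<c , pb , pa , pc
... | tri> _ _ b<a | tri< b<c _ _ | tri> _ _ c<a = b , c , a , b<c , c<a , pb , pc , pa
... | tri> _ _ b<a | tri> _ _ c<b | _            = c , b , a , c<b , b<a , pc , pb , pa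

∃-three-free : ∀ {m xs} → 3 + length xs ≤ m →
  ∃ λ t₁ → ∃ λ t₂ → ∃ λ t₃ → t₁ < t₂ × t₂ < t₃ ×
    FreeBelow m xs t₁ × FreeBelow m xs t₂ × FreeBelow m xs t₃
∃-three-free {m} {xs} 3+ℓ≤m
  with a , a<m , a∉ ← ∃-free {m} {xs} (≤-trans (n≤1+n _) (≤-trans (n≤1+n _) 3+ℓ≤m))
  with b , b<m , b∉ ← ∃-free {m} {a ∷ xs} (≤-trans (n≤1+n _) 3+ℓ≤m)
  with c , c<m , c∉ ← ∃-free {m} {b ∷ a ∷ xs} 3+ℓ≤m
  = sort₃ (FreeBelow m xs) (λ a≡b → b∉ (here (≡.sym a≡b))) (λ b≡c → c∉ (here (≡.sym b≡c)))
          (λ a≡c → c∉ (there (here (≡.sym a≡c))))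
          (a<m , a∉) (b<m , b∉ ∘ there) (c<m , c∉ ∘ there ∘ there)

-- Affine equations and squares

cross-cancel-≤ : ∀ {p q x y} → p ≢ q → x ≤ y → p * x + q * y ≡ q * x + p * y → x ≡ y
cross-cancel-≤ {p} {q} {x} p≢q x≤y eq with m≤n⇒∃[o]m+o≡n x≤y
... | zero  , refl = ≡.sym (+-identityʳ x)
... | suc k , refl = contradiction (≡.sym (*-cancelʳ-≡ q p (suc k) q[1+k]≡p[1+k])) p≢q
  where
  split : ∀ p q x k → p * x + q * (x + k) ≡ p * x + q * x + q * k
  split = solve-∀
  q[1+k]≡p[1+k] : q * suc k ≡ p * suc k
  q[1+k]≡p[1+k] = +-cancelˡ-≡ (p * x + q * x) _ _ (begin
    p * x + q * x + q * suc k   ≡⟨ split p q x (suc k) ⟨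
    p * x + q * (x + suc k)     ≡⟨ eq ⟩
    q * x + p * (x + suc k)     ≡⟨ split q p x (suc k) ⟩
    q * x + p * x + p * suc k   ≡⟨ cong (_+ p * suc k) (+-comm (q * x) (p * x)) ⟩
    p * x + q * x + p * suc k   ∎)
    where open ≡-Reasoning

cross-cancel : ∀ {p q x y} → p ≢ q → p * x + q * y ≡ q * x + p * y → x ≡ y
cross-cancel {p} {q} {x} {y} p≢q eq with ≤-total x y
... | inj₁ x≤y = cross-cancel-≤ p≢q x≤y eq
... | inj₂ y≤x = ≡.sym (cross-cancel-≤ p≢q y≤x
                   (trans (+-comm (p * y) (q * x)) (trans (≡.sym eq) (+-comm (p * x) (q * y)))))

affine-root-unique : ∀ {K L p q x y} → p ≢ q → K + p * x ≡ L + q * x → K + p * y ≡ L + q * y → x ≡ y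
affine-root-unique {K} {L} {p} {q} {x} {y} p≢q ex ey = cross-cancel p≢q (+-cancelˡ-≡ (K + L) _ _ (begin
  K + L + (p * x + q * y)    ≡⟨ interchange K L (p * x) (q * y) ⟩
  (K + p * x) + (L + q * y)  ≡⟨ cong₂ _+_ ex (≡.sym ey) ⟩
  (L + q * x) + (K + p * y)  ≡⟨ interchange′ K L (q * x) (p * y) ⟩
  K + L + (q * x + p * y)    ∎))
  where
  interchange : ∀ a b c d → a + b + (c + d) ≡ (a + c) + (b + d)
  interchange = solve-∀
  interchange′ : ∀ a b c d → (b + c) + (a + d) ≡ a + b + (c + d)
  interchange′ = solve-∀
  open ≡-Reasoning

record AffineEquation : Set where
  constructor affine
  field K L α α′ β β′ : ℕ

Solves : AffineEquation → ℕ → ℕ → Set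
Solves (affine K L α α′ β β′) t s = K + α * t + β * s ≡ L + α′ * t + β′ * s

solutions-unique-in-t : ∀ E {t t′ s} → AffineEquation.α E ≢ AffineEquation.α′ E →
  Solves E t s → Solves E t′ s → t ≡ t′
solutions-unique-in-t (affine K L α α′ β β′) {s = s} α≢α′ e e′ =
  affine-root-unique α≢α′ (move-s K L α α′ e) (move-s K L α α′ e′)
  where
  move-s : ∀ K L α α′ {t} → K + α * t + β * s ≡ L + α′ * t + β′ * s →
           K + β * s + α * t ≡ L + β′ * s + α′ * t
  move-s K L α α′ {t} e =
    trans (≡.sym (xy∙z≈xz∙y K (α * t) (β * s))) (trans e (xy∙z≈xz∙y L (α′ * t) (β′ * s)))

solutions-collinear : ∀ E {t a b s₁ s₂ s₃} → AffineEquation.β E ≢ AffineEquation.β′ E →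
  Solves E t s₁ → Solves E (t + a) s₂ → Solves E (t + a + b) s₃ → b * s₁ + a * s₃ ≡ (a + b) * s₂
solutions-collinear (affine K L α α′ β β′) {t} {a} {b} {s₁} {s₂} {s₃} β≢β′ e₁ e₂ e₃ =
  affine-root-unique β≢β′ outer middle
  where
  open ≡-Reasoning
  combine : ∀ K α β t a b s₁ s₃ →
    (a + b) * K + α * ((a + b) * (t + a)) + β * (b * s₁ + a * s₃)
      ≡ b * (K + α * t + β * s₁) + a * (K + α * (t + a + b) + β * s₃)
  combine = solve-∀
  scale : ∀ K α β t a b s →
    (a + b) * K + α * ((a + b) * (t + a)) + β * ((a + b) * s) ≡ (a + b) * (K + α * (t + a) + β * s)
  scale = solve-∀
  outer : (a + b) * K + α * ((a + b) * (t + a)) + β * (b * s₁ + a * s₃)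
        ≡ (a + b) * L + α′ * ((a + b) * (t + a)) + β′ * (b * s₁ + a * s₃)
  outer = begin
    _ ≡⟨ combine K α β t a b s₁ s₃ ⟩
    b * (K + α * t + β * s₁) + a * (K + α * (t + a + b) + β * s₃)
      ≡⟨ cong₂ (λ u v → b * u + a * v) e₁ e₃ ⟩
    b * (L + α′ * t + β′ * s₁) + a * (L + α′ * (t + a + b) + β′ * s₃)
      ≡⟨ combine L α′ β′ t a b s₁ s₃ ⟨
    _ ∎
  middle : (a + b) * K + α * ((a + b) * (t + a)) + β * ((a + b) * s₂)
         ≡ (a + b) * L + α′ * ((a + b) * (t + a)) + β′ * ((a + b) * s₂)
  middle = begin
    _ ≡⟨ scale K α β t a b s₂ ⟩
    (a + b) * (K + α * (t + a) + β * s₂)    ≡⟨ cong ((a + b) *_) e₂ ⟩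
    (a + b) * (L + α′ * (t + a) + β′ * s₂)  ≡⟨ scale L α′ β′ t a b s₂ ⟨
    _ ∎

weighted-squares : ∀ a b x z →
  (a + b) * b * (x * x) + (a + b) * a * (z * z) ≡ (b * x + a * z) * (b * x + a * z) + a * b * (∣ x - z ∣ * ∣ x - z ∣)
weighted-squares a b x z with ≤-total z x
... | inj₁ z≤x with d , refl ← m≤n⇒∃[o]m+o≡n z≤x
  rewrite trans (m≤n⇒∣n-m∣≡n∸m (m≤m+n z d)) (m+n∸m≡n z d) = identity a b z d
  where
  identity : ∀ a b z d → (a + b) * b * ((z + d) * (z + d)) + (a + b) * a * (z * z)
                       ≡ (b * (z + d) + a * z) * (b * (z + d) + a * z) + a * b * (d * d)
  identity = solve-∀
... | inj₂ x≤z with d , refl ← m≤n⇒∃[o]m+o≡n x≤z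
  rewrite trans (m≤n⇒∣m-n∣≡n∸m (m≤m+n x d)) (m+n∸m≡n x d) = identity a b x d
  where
  identity : ∀ a b x d → (a + b) * b * (x * x) + (a + b) * a * ((x + d) * (x + d))
                       ≡ (b * x + a * (x + d)) * (b * x + a * (x + d)) + a * b * (d * d)
  identity = solve-∀

mean-square-excess : ∀ a b x y z → b * x + a * z ≡ (a + b) * y →
  (a + b) * b * (x * x) + (a + b) * a * (z * z) ≡ (a + b) * (a + b) * (y * y) + a * b * (∣ x - z ∣ * ∣ x - z ∣)
mean-square-excess a b x y z mean = begin
  (a + b) * b * (x * x) + (a + b) * a * (z * z)
    ≡⟨ weighted-squares a b x z ⟩
  (b * x + a * z) * (b * x + a * z) + a * b * (∣ x - z ∣ * ∣ x - z ∣)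
    ≡⟨ cong (λ m → m * m + a * b * (∣ x - z ∣ * ∣ x - z ∣)) mean ⟩
  ((a + b) * y) * ((a + b) * y) + a * b * (∣ x - z ∣ * ∣ x - z ∣)
    ≡⟨ cong (_+ a * b * (∣ x - z ∣ * ∣ x - z ∣)) (square-product (a + b) y) ⟩
  (a + b) * (a + b) * (y * y) + a * b * (∣ x - z ∣ * ∣ x - z ∣) ∎
  where
  open ≡-Reasoning
  square-product : ∀ c y → (c * y) * (c * y) ≡ c * c * (y * y)
  square-product = solve-∀

equal-square-sums⇒ends-agree : ∀ {A : Set} (xs : List A) (f₁ f₂ f₃ : A → ℕ) {a b S} → 0 < a → 0 < b →
  (∀ {p} → p ∈ xs → b * f₁ p + a * f₃ p ≡ (a + b) * f₂ p) →
  sum (map (λ p → f₁ p * f₁ p) xs) ≡ S → sum (map (λ p → f₂ p * f₂ p) xs) ≡ S →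
  sum (map (λ p → f₃ p * f₃ p) xs) ≡ S → ∀ {p} → p ∈ xs → f₁ p ≡ f₃ p
equal-square-sums⇒ends-agree {A} xs f₁ f₂ f₃ {a} {b} {S} 0<a 0<b mean S₁ S₂ S₃ p∈ =
  ∣m-n∣≡0⇒m≡n (square≡0 (sum-map≡0 D ∑D≡0 p∈))
  where
  open ≡-Reasoning
  D : A → ℕ
  D p = ∣ f₁ p - f₃ p ∣ * ∣ f₁ p - f₃ p ∣
  square≡0 : ∀ {k} → k * k ≡ 0 → k ≡ 0
  square≡0 {k} k²≡0 with m*n≡0⇒m≡0∨n≡0 k k²≡0
  ... | inj₁ k≡0 = k≡0
  ... | inj₂ k≡0 = k≡0
  recombine : ∀ a b S → (a + b) * b * S + (a + b) * a * S ≡ (a + b) * (a + b) * S + 0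
  recombine = solve-∀
  ab∑D≡0 : a * b * sum (map D xs) ≡ 0
  ab∑D≡0 = +-cancelˡ-≡ ((a + b) * (a + b) * S) _ _ (begin
    (a + b) * (a + b) * S + a * b * sum (map D xs)
      ≡⟨ cong (λ s → (a + b) * (a + b) * s + a * b * sum (map D xs)) S₂ ⟨
    (a + b) * (a + b) * sum (map (λ p → f₂ p * f₂ p) xs) + a * b * sum (map D xs)
      ≡⟨ sum-map-linear ((a + b) * (a + b)) (a * b) (λ p → f₂ p * f₂ p) D xs ⟨
    sum (map (λ p → (a + b) * (a + b) * (f₂ p * f₂ p) + a * b * D p) xs)
      ≡⟨ sum-map-cong xs (λ p∈ → mean-square-excess a b _ _ _ (mean p∈)) ⟨
    sum (map (λ p → (a + b) * b * (f₁ p * f₁ p) + (a + b) * a * (f₃ p * f₃ p)) xs)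
      ≡⟨ sum-map-linear ((a + b) * b) ((a + b) * a) (λ p → f₁ p * f₁ p) (λ p → f₃ p * f₃ p) xs ⟩
    (a + b) * b * sum (map (λ p → f₁ p * f₁ p) xs) + (a + b) * a * sum (map (λ p → f₃ p * f₃ p) xs)
      ≡⟨ cong₂ (λ s s′ → (a + b) * b * s + (a + b) * a * s′) S₁ S₃ ⟩
    (a + b) * b * S + (a + b) * a * S
      ≡⟨ recombine a b S ⟩
    (a + b) * (a + b) * S + 0 ∎)
  ∑D≡0 : sum (map D xs) ≡ 0
  ∑D≡0 with m*n≡0⇒m≡0∨n≡0 (a * b) ab∑D≡0
  ... | inj₁ ab≡0 = contradiction (≡.sym ab≡0) (<⇒≢ (*-mono-≤ 0<a 0<b))
  ... | inj₂ ∑D≡0 = ∑D≡0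

-- Graphs and the pushing sum σ

module _ {n : ℕ} (G : Graph n) where

  infix 4 _~_ _~?_

  _~_ : Fin n → Fin n → Set
  u ~ v = adj G u v ≡ true

  _~?_ : ∀ u v → Dec (u ~ v)
  u ~? v = adj G u v Bool.≟ true

  ~-sym : ∀ {u v} → u ~ v → v ~ u
  ~-sym {u} {v} u~v = trans (Graph.sym G v u) u~v

  ~-irrefl : ∀ {u v} → u ~ v → u ≢ v
  ~-irrefl {u} u~u refl = contradiction (trans (≡.sym u~u) (irrefl G u)) λ ()

  deg≡∑ : ∀ u → deg G u ≡ ∑[ v < n ] 𝟙 (u ~? v)
  deg≡∑ u = trans (sum-map-allFin (λ v → if adj G u v then 1 else 0)) (sum-cong-≗ indicator)
    where
    indicator : ∀ v → (if adj G u v then 1 else 0) ≡ 𝟙 (u ~? v)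
    indicator v with adj G u v
    ... | true  = refl
    ... | false = refl

  deg-pos : ∀ {u v} → u ~ v → 1 ≤ deg G u
  deg-pos {u} {v} u~v = subst (1 ≤_) (≡.sym (deg≡∑ u)) (1≤∑𝟙 (u ~?_) v u~v)

  deg≡1-unique : ∀ {a b c} → deg G a ≡ 1 → a ~ b → a ~ c → b ≡ c
  deg≡1-unique {a} {b} {c} deg≡1 a~b a~c with b ≟ᶠ c
  ... | yes b≡c = b≡c
  ... | no  b≢c = contradiction (subst (2 ≤_) deg≡1 2≤deg) (<-irrefl refl)
    where
    open ≤-Reasoning
    2≤deg : 2 ≤ deg G a
    2≤deg = begin
      2                               ≡⟨ cong₂ _+_ (𝟙-yes (a ~? b) a~b) (𝟙-yes (a ~? c) a~c) ⟨
      𝟙 (a ~? b) + 𝟙 (a ~? c)         ≤⟨ ≤-∑-pair (λ v → 𝟙 (a ~? v)) b≢c ⟩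
      ∑[ v < n ] 𝟙 (a ~? v)           ≡⟨ deg≡∑ a ⟨
      deg G a                         ∎

  isolated-edge : ∀ {u y} → u ~ y → deg G u ≡ 1 → deg G y ≡ 1 → HasComponentOfOrderTwo G
  isolated-edge {u} {y} u~y du≡1 dy≡1 = u , y , ~-irrefl u~y , step u~y here , λ _ → closed (inj₁ refl)
    where
    closed : ∀ {a w} → a ≡ u ⊎ a ≡ y → Reach G a w → w ≡ u ⊎ w ≡ y
    closed a∈ here = a∈
    closed (inj₁ refl) (step u~v r) = closed (inj₂ (≡.sym (deg≡1-unique du≡1 u~y u~v))) r
    closed (inj₂ refl) (step y~v r) = closed (inj₁ (≡.sym (deg≡1-unique dy≡1 (~-sym u~y) y~v))) r

  2≤deg-beside-leaf : Nice G → ∀ {w x} → w ~ x → deg G x ≡ 1 → 2 ≤ deg G w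
  2≤deg-beside-leaf nice w~x dx≡1 =
    ≤∧≢⇒< (deg-pos w~x) (λ 1≡dw → nice (isolated-edge w~x (≡.sym 1≡dw) dx≡1))

  ∃-other-neighbour : ∀ {w} → 2 ≤ deg G w → ∀ x → ∃ λ y → y ≢ x × w ~ y
  ∃-other-neighbour {w} 2≤deg x =
    let y , y≢x , pos = ∃-other-positive-term (λ v → 𝟙 (w ~? v)) x
                          (≤-trans (s≤s (𝟙≤1 (w ~? x))) (subst (2 ≤_) (deg≡∑ w) 2≤deg))
    in y , y≢x , 𝟙-pos (w ~? y) pos

  influence : Fin n → Fin n → ℕ
  influence u z = 𝟙 (u ≟ᶠ z) * deg G u + 𝟙 (u ~? z)

  influence-self : ∀ u → influence u u ≡ deg G u
  influence-self u = begin
    𝟙 (u ≟ᶠ u) * deg G u + 𝟙 (u ~? u)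
      ≡⟨ cong₂ (λ i j → i * deg G u + j) (𝟙-yes (u ≟ᶠ u) refl)
               (𝟙-no (u ~? u) (λ u~u → ~-irrefl u~u refl)) ⟩
    1 * deg G u + 0  ≡⟨ +-identityʳ _ ⟩
    1 * deg G u      ≡⟨ *-identityˡ _ ⟩
    deg G u          ∎
    where open ≡-Reasoning

  influence-adjacent : ∀ {u z} → u ~ z → influence u z ≡ 1
  influence-adjacent {u} {z} u~z =
    cong₂ (λ i j → i * deg G u + j) (𝟙-no (u ≟ᶠ z) (~-irrefl u~z)) (𝟙-yes (u ~? z) u~z)

  influence-far : ∀ {u z} → u ≢ z → ¬ u ~ z → influence u z ≡ 0
  influence-far {u} {z} u≢z ¬u~z =
    cong₂ (λ i j → i * deg G u + j) (𝟙-no (u ≟ᶠ z) u≢z) (𝟙-no (u ~? z) ¬u~z)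

  _[_≔_] : (Fin n → ℕ) → Fin n → ℕ → Fin n → ℕ
  ρ [ z ≔ t ] = updateAt ρ z (const t)

  nbrSum-update : ∀ ρ z t u → nbrSum G (ρ [ z ≔ t ]) u + 𝟙 (u ~? z) * ρ z ≡ nbrSum G ρ u + 𝟙 (u ~? z) * t
  nbrSum-update ρ z t u = begin
    nbrSum G (ρ [ z ≔ t ]) u + 𝟙 (u ~? z) * ρ z
      ≡⟨ cong₂ _+_ (sum-map-allFin (λ v → h v ((ρ [ z ≔ t ]) v))) (if-adj≡𝟙* z (ρ z)) ⟩
    ∑[ v < n ] h v ((ρ [ z ≔ t ]) v) + h z (ρ z)
      ≡⟨ ∑-updateAt h ρ z t ⟩
    ∑[ v < n ] h v (ρ v) + h z t
      ≡⟨ cong₂ _+_ (sum-map-allFin (λ v → h v (ρ v))) (if-adj≡𝟙* z t) ⟨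
    nbrSum G ρ u + 𝟙 (u ~? z) * t ∎
    where
    open ≡-Reasoning
    h : Fin n → ℕ → ℕ
    h v r = if adj G u v then r else 0
    if-adj≡𝟙* : ∀ v r → 𝟙 (u ~? v) * r ≡ h v r
    if-adj≡𝟙* v r with adj G u v
    ... | true  = +-identityʳ r
    ... | false = refl

  self-update : ∀ ρ z t u → (1 + (ρ [ z ≔ t ]) u) * deg G u + 𝟙 (u ≟ᶠ z) * deg G u * ρ z
                          ≡ (1 + ρ u) * deg G u + 𝟙 (u ≟ᶠ z) * deg G u * t
  self-update ρ z t u with u ≟ᶠ z
  ... | yes refl rewrite updateAt-updates u {const t} ρ = exchange t (ρ u) (deg G u)
    where
    exchange : ∀ t r d → (1 + t) * d + 1 * d * r ≡ (1 + r) * d + 1 * d * t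
    exchange = solve-∀
  ... | no  u≢z  rewrite updateAt-minimal u z {const t} ρ u≢z = refl

  σ-update : ∀ ρ z t u → σ G (ρ [ z ≔ t ]) u + influence u z * ρ z ≡ σ G ρ u + influence u z * t
  σ-update ρ z t u = begin
    (1 + ρ′ u) * d + nbrSum G ρ′ u + (i * d + j) * ρ z
      ≡⟨ split ((1 + ρ′ u) * d) (nbrSum G ρ′ u) (i * d) j (ρ z) ⟩
    ((1 + ρ′ u) * d + i * d * ρ z) + (nbrSum G ρ′ u + j * ρ z)
      ≡⟨ cong₂ _+_ (self-update ρ z t u) (nbrSum-update ρ z t u) ⟩
    ((1 + ρ u) * d + i * d * t) + (nbrSum G ρ u + j * t)
      ≡⟨ split ((1 + ρ u) * d) (nbrSum G ρ u) (i * d) j t ⟨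
    (1 + ρ u) * d + nbrSum G ρ u + (i * d + j) * t ∎
    where
    open ≡-Reasoning
    ρ′ = ρ [ z ≔ t ]
    d = deg G u
    i = 𝟙 (u ≟ᶠ z)
    j = 𝟙 (u ~? z)
    split : ∀ a b c e r → a + b + (c + e) * r ≡ (a + c * r) + (b + e * r)
    split = solve-∀

  Collides : (Fin n → ℕ) → Fin n × Fin n → Set
  Collides ρ (u , y) = σ G ρ u ≡ σ G ρ y

  collides? : ∀ ρ → Decidable (Collides ρ)
  collides? ρ (u , y) = σ G ρ u ≟ σ G ρ y

  collision-equation : ∀ {ρ z t u y} → Collides (ρ [ z ≔ t ]) (u , y) →
    σ G ρ u + influence y z * ρ z + influence u z * t ≡ σ G ρ y + influence u z * ρ z + influence y z * t
  collision-equation {ρ} {z} {t} {u} {y} collides = begin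
    σ G ρ u + cy * r + cu * t     ≡⟨ xy∙z≈xz∙y (σ G ρ u) (cy * r) (cu * t) ⟩
    σ G ρ u + cu * t + cy * r     ≡⟨ cong (_+ cy * r) (σ-update ρ z t u) ⟨
    σ′ u + cu * r + cy * r        ≡⟨ xy∙z≈xz∙y (σ′ u) (cu * r) (cy * r) ⟩
    σ′ u + cy * r + cu * r        ≡⟨ cong (λ v → v + cy * r + cu * r) collides ⟩
    σ′ y + cy * r + cu * r        ≡⟨ cong (_+ cu * r) (σ-update ρ z t y) ⟩
    σ G ρ y + cy * t + cu * r     ≡⟨ xy∙z≈xz∙y (σ G ρ y) (cy * t) (cu * r) ⟩
    σ G ρ y + cu * r + cy * t     ∎
    where
    open ≡-Reasoning
    σ′ = σ G (ρ [ z ≔ t ])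
    r = ρ z
    cu = influence u z
    cy = influence y z

  collision-balanced : ∀ {ρ z t u y} → influence u z ≡ influence y z →
                       Collides (ρ [ z ≔ t ]) (u , y) → Collides ρ (u , y)
  collision-balanced {ρ} {z} {t} {u} {y} same collides = +-cancelʳ-≡ _ _ _ (+-cancelʳ-≡ _ _ _
    (subst (λ c → σ G ρ u + c * ρ z + influence u z * t ≡ σ G ρ y + influence u z * ρ z + c * t)
           (≡.sym same) (collision-equation collides)))

  offset : (Fin n → ℕ) → Fin n → Fin n → Fin n → ℕ
  offset ρ w x v = influence v x * ρ x + influence v w * ρ w

  σ-update₂ : ∀ {ρ w x} t s v → x ≢ w →
    σ G (ρ [ w ≔ t ] [ x ≔ s ]) v + offset ρ w x v ≡ σ G ρ v + influence v w * t + influence v x * s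
  σ-update₂ {ρ} {w} {x} t s v x≢w = begin
    σ″ v + (cx * ρ x + cw * ρ w)         ≡⟨ +-assoc (σ″ v) (cx * ρ x) (cw * ρ w) ⟨
    σ″ v + cx * ρ x + cw * ρ w           ≡⟨ cong (λ r → σ″ v + cx * r + cw * ρ w) (updateAt-minimal x w ρ x≢w) ⟨
    σ″ v + cx * (ρ [ w ≔ t ]) x + cw * ρ w ≡⟨ cong (_+ cw * ρ w) (σ-update (ρ [ w ≔ t ]) x s v) ⟩
    σ′ v + cx * s + cw * ρ w             ≡⟨ xy∙z≈xz∙y (σ′ v) (cx * s) (cw * ρ w) ⟩
    σ′ v + cw * ρ w + cx * s             ≡⟨ cong (_+ cx * s) (σ-update ρ w t v) ⟩
    σ G ρ v + cw * t + cx * s            ∎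
    where
    open ≡-Reasoning
    σ′ = σ G (ρ [ w ≔ t ])
    σ″ = σ G (ρ [ w ≔ t ] [ x ≔ s ])
    cw = influence v w
    cx = influence v x

  pair-equation : (Fin n → ℕ) → Fin n → Fin n → Fin n × Fin n → AffineEquation
  pair-equation ρ w x (u , y) = affine (σ G ρ u + offset ρ w x y) (σ G ρ y + offset ρ w x u)
                                       (influence u w) (influence y w) (influence u x) (influence y x)

  collision-equation₂ : ∀ {ρ w x t s u y} → x ≢ w → Collides (ρ [ w ≔ t ] [ x ≔ s ]) (u , y) →
                        Solves (pair-equation ρ w x (u , y)) t s
  collision-equation₂ {ρ} {w} {x} {t} {s} {u} {y} x≢w collides = begin
    σ G ρ u + Cy + αu * t + βu * s    ≡⟨ rotate (σ G ρ u) Cy (αu * t) (βu * s) ⟩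
    σ G ρ u + αu * t + βu * s + Cy    ≡⟨ cong (_+ Cy) (σ-update₂ t s u x≢w) ⟨
    σ″ u + Cu + Cy                    ≡⟨ xy∙z≈xz∙y (σ″ u) Cu Cy ⟩
    σ″ u + Cy + Cu                    ≡⟨ cong (λ v → v + Cy + Cu) collides ⟩
    σ″ y + Cy + Cu                    ≡⟨ cong (_+ Cu) (σ-update₂ t s y x≢w) ⟩
    σ G ρ y + αy * t + βy * s + Cu    ≡⟨ rotate (σ G ρ y) Cu (αy * t) (βy * s) ⟨
    σ G ρ y + Cu + αy * t + βy * s    ∎
    where
    open ≡-Reasoning
    σ″ = σ G (ρ [ w ≔ t ] [ x ≔ s ])
    Cu = offset ρ w x u
    Cy = offset ρ w x y
    αu = influence u w
    αy = influence y w
    βu = influence u x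
    βy = influence y x
    rotate : ∀ a b c d → a + b + c + d ≡ a + c + d + b
    rotate = solve-∀

  Balanced : List (Fin n) → Fin n → Fin n → Set
  Balanced R u y = All (λ z → influence u z ≡ influence y z) R

  balanced? : ∀ R u y → Dec (Balanced R u y)
  balanced? R u y = all? (λ z → influence u z ≟ influence y z) R

  balanced-sym : ∀ {R u y} → Balanced R u y → Balanced R y u
  balanced-sym = All.map ≡.sym

  unbalanced-edge-near : ∀ {u y z} → u ~ y → influence u z ≢ influence y z → z ~ u ⊎ z ~ y
  unbalanced-edge-near {u} {y} {z} u~y differ with z ~? u | z ~? y
  ... | yes z~u | _       = inj₁ z~u
  ... | no _    | yes z~y = inj₂ z~y
  ... | no ¬z~u | no ¬z~y =
    contradiction (trans (far u~y ¬z~y ¬z~u) (≡.sym (far (~-sym u~y) ¬z~u ¬z~y))) differ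
    where
    far : ∀ {u y} → u ~ y → ¬ z ~ y → ¬ z ~ u → influence u z ≡ 0
    far u~y ¬z~y ¬z~u = influence-far (λ { refl → ¬z~y u~y }) (¬z~u ∘ ~-sym)

  -- R lists the vertices still to be fixed; changing their values preserves σ u − σ y on R-balanced edges.
  ProperOnBalanced : List (Fin n) → (Fin n → ℕ) → Set
  ProperOnBalanced R ρ = ∀ {u y} → u ~ y → Balanced R u y → σ G ρ u ≢ σ G ρ y

  proper-on-allFin : Nice G → ∀ ρ → ProperOnBalanced (allFin n) ρ
  proper-on-allFin nice ρ u~y bal _ =
    nice (isolated-edge u~y (leaf u~y bal) (leaf (~-sym u~y) (balanced-sym bal)))
    where
    leaf : ∀ {u y} → u ~ y → Balanced (allFin n) u y → deg G u ≡ 1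
    leaf {u} u~y bal = trans (≡.sym (influence-self u))
                             (trans (All.lookup bal (∈-allFin u)) (influence-adjacent (~-sym u~y)))

  proper-on-[] : ∀ {ρ} → ProperOnBalanced [] ρ → ProperPushingScheme G ρ
  proper-on-[] proper _ _ u~v = proper u~v []

  proper-on-⊆ : ∀ {R R′ ρ} → R ⊆ R′ → ProperOnBalanced R ρ → ProperOnBalanced R′ ρ
  proper-on-⊆ R⊆R′ proper u~y bal = proper u~y (anti-mono R⊆R′ bal)

  proper-on-isolated : ∀ {v R ρ} → (∀ u → ¬ v ~ u) → ProperOnBalanced (v ∷ R) ρ → ProperOnBalanced R ρ
  proper-on-isolated {v} isolated proper u~y bal =
    proper u~y (trans (unaffected u~y) (≡.sym (unaffected (~-sym u~y))) ∷ bal)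
    where
    unaffected : ∀ {u y} → u ~ y → influence u v ≡ 0
    unaffected {u} {y} u~y = influence-far (λ { refl → isolated y u~y }) (isolated u ∘ ~-sym)

  Critical : Fin n → List (Fin n) → Fin n × Fin n → Set
  Critical z R (u , y) = z ~ u × u ~ y × Balanced R u y × influence u z ≢ influence y z

  critical? : ∀ z R → Decidable (Critical z R)
  critical? z R (u , y) =
    z ~? u ×-dec u ~? y ×-dec balanced? R u y ×-dec ¬? (influence u z ≟ influence y z)

  criticalPairs : Fin n → List (Fin n) → List (Fin n × Fin n)
  criticalPairs z R = filter (critical? z R) (allPairs n)

  ∈-criticalPairs⁺ : ∀ {z R u y} → Critical z R (u , y) → (u , y) ∈ criticalPairs z R
  ∈-criticalPairs⁺ {z} {R} {u} {y} = ∈-filter⁺ (critical? z R) (∈-allPairs u y)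

  ∈-criticalPairs⁻ : ∀ {z R p} → p ∈ criticalPairs z R → Critical z R p
  ∈-criticalPairs⁻ {z} {R} = proj₂ ∘ ∈-filter⁻ (critical? z R) {xs = allPairs n}

  path? : ∀ z u y → Dec (z ~ u × u ~ y)
  path? z u y = z ~? u ×-dec u ~? y

  pathCount : Fin n → ℕ
  pathCount z = ∑[ u < n ] (𝟙 (z ~? u) * deg G u)

  ∑-neighbours : ∀ z c → ∑[ u < n ] (𝟙 (z ~? u) * c) ≡ deg G z * c
  ∑-neighbours z c = trans (≡.sym (*-distribʳ-sum c (λ u → 𝟙 (z ~? u)))) (cong (_* c) (≡.sym (deg≡∑ z)))

  paths-through : ∀ z u → ∑[ y < n ] 𝟙 (path? z u y) ≡ 𝟙 (z ~? u) * deg G u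
  paths-through z u = begin
    ∑[ y < n ] 𝟙 (path? z u y)            ≡⟨ sum-cong-≗ (λ y → 𝟙-× (z ~? u) (u ~? y)) ⟩
    ∑[ y < n ] (𝟙 (z ~? u) * 𝟙 (u ~? y))  ≡⟨ *-distribˡ-sum (𝟙 (z ~? u)) (λ y → 𝟙 (u ~? y)) ⟨
    𝟙 (z ~? u) * ∑[ y < n ] 𝟙 (u ~? y)    ≡⟨ cong (𝟙 (z ~? u) *_) (deg≡∑ u) ⟨
    𝟙 (z ~? u) * deg G u                  ∎
    where open ≡-Reasoning

  ∑-below-paths : ∀ z (F : Fin n → Fin n → ℕ) → (∀ u y → F u y ≤ 𝟙 (path? z u y)) →
                  ∑[ u < n ] ∑[ y < n ] F u y ≤ pathCount z
  ∑-below-paths z F F≤ = ∑-mono-≤ (λ u → ≤-trans (∑-mono-≤ (F≤ u)) (≤-reflexive (paths-through z u)))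

  pathCount≤ : ∀ {Δ} → MaxDegreeAtMost G Δ → ∀ z → pathCount z ≤ deg G z * Δ
  pathCount≤ {Δ} maxdeg z =
    ≤-trans (∑-mono-≤ (λ u → *-monoʳ-≤ (𝟙 (z ~? u)) (maxdeg u))) (≤-reflexive (∑-neighbours z Δ))

  critical⇒path : ∀ z R u y → 𝟙 (critical? z R (u , y)) ≤ 𝟙 (path? z u y)
  critical⇒path z R u y = 𝟙-mono (critical? z R (u , y)) (path? z u y) (λ (z~u , u~y , _) → z~u , u~y)

  #critical≤pathCount : ∀ z R → length (criticalPairs z R) ≤ pathCount z
  #critical≤pathCount z R = subst (_≤ pathCount z) (≡.sym (length-filter-allPairs (critical? z R)))
                                  (∑-below-paths z _ (critical⇒path z R))

  -- Paths from w that x unbalances: counted in pathCount w, but never critical for w while x is unfixed.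
  Wasted : Fin n → Fin n → Fin n × Fin n → Set
  Wasted w x (u , y) = w ~ u × u ~ y × influence u x ≢ influence y x

  wasted? : ∀ w x → Decidable (Wasted w x)
  wasted? w x (u , y) = w ~? u ×-dec u ~? y ×-dec ¬? (influence u x ≟ influence y x)

  #wasted : Fin n → Fin n → ℕ
  #wasted w x = ∑[ u < n ] ∑[ y < n ] 𝟙 (wasted? w x (u , y))

  #critical+#wasted≤pathCount : ∀ w x R → length (criticalPairs w (x ∷ R)) + #wasted w x ≤ pathCount w
  #critical+#wasted≤pathCount w x R = begin
    length (criticalPairs w (x ∷ R)) + #wasted w x
      ≡⟨ cong (_+ #wasted w x) (length-filter-allPairs (critical? w (x ∷ R))) ⟩
    ∑[ u < n ] ∑[ y < n ] C u y + ∑[ u < n ] ∑[ y < n ] W u y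
      ≡⟨ ∑-distrib-+ (λ u → ∑[ y < n ] C u y) (λ u → ∑[ y < n ] W u y) ⟨
    ∑[ u < n ] (∑[ y < n ] C u y + ∑[ y < n ] W u y)
      ≡⟨ sum-cong-≗ (λ u → ∑-distrib-+ (C u) (W u)) ⟨
    ∑[ u < n ] ∑[ y < n ] (C u y + W u y)
      ≤⟨ ∑-below-paths w (λ u y → C u y + W u y) disjoint ⟩
    pathCount w ∎
    where
    open ≤-Reasoning
    C W : Fin n → Fin n → ℕ
    C u y = 𝟙 (critical? w (x ∷ R) (u , y))
    W u y = 𝟙 (wasted? w x (u , y))
    disjoint : ∀ u y → C u y + W u y ≤ 𝟙 (path? w u y)
    disjoint u y = 𝟙-disjoint (critical? w (x ∷ R) (u , y)) (wasted? w x (u , y)) (path? w u y)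
      (λ { (_ , _ , same ∷ _ , _) (_ , _ , differ) → differ same })
      (λ (w~u , u~y , _) → w~u , u~y) (λ (w~u , u~y , _) → w~u , u~y)

  wasted-row-self : ∀ {w x} → w ~ x → deg G x ≢ 1 → deg G x ≤ ∑[ y < n ] 𝟙 (wasted? w x (x , y))
  wasted-row-self {w} {x} w~x dx≢1 =
    subst (_≤ ∑[ y < n ] 𝟙 (wasted? w x (x , y))) (≡.sym (deg≡∑ x)) (∑-mono-≤ λ y →
      𝟙-mono (x ~? y) (wasted? w x (x , y)) λ x~y → w~x , x~y , λ same →
        dx≢1 (trans (≡.sym (influence-self x)) (trans same (influence-adjacent (~-sym x~y)))))

  wasted-row-other : ∀ {w x y₀} → w ~ x → w ~ y₀ → y₀ ≢ x → (y₀ ~ x → deg G x ≢ 1) →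
                     1 ≤ ∑[ y < n ] 𝟙 (wasted? w x (y₀ , y))
  wasted-row-other {w} {x} {y₀} w~x w~y₀ y₀≢x dx≢1 = witness (y₀ ~? x)
    where
    witness : Dec (y₀ ~ x) → 1 ≤ ∑[ y < n ] 𝟙 (wasted? w x (y₀ , y))
    witness (yes y₀~x) = 1≤∑𝟙 (λ y → wasted? w x (y₀ , y)) x (w~y₀ , y₀~x , λ same →
      dx≢1 y₀~x (trans (≡.sym (influence-self x)) (trans (≡.sym same) (influence-adjacent y₀~x))))
    witness (no ¬y₀~x) = 1≤∑𝟙 (λ y → wasted? w x (y₀ , y)) w (w~y₀ , ~-sym w~y₀ , λ same →
      contradiction (trans (≡.sym (influence-far y₀≢x ¬y₀~x)) (trans same (influence-adjacent w~x))) λ ())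

  #wasted-pos : Nice G → ∀ {w x} → w ~ x → 1 ≤ #wasted w x
  #wasted-pos nice {w} {x} w~x with deg G x ≟ 1
  ... | no dx≢1 = ≤-trans (deg-pos (~-sym w~x)) (≤-trans (wasted-row-self w~x dx≢1) (≤-∑ _ x))
  ... | yes dx≡1 with y₀ , y₀≢x , w~y₀ ← ∃-other-neighbour (2≤deg-beside-leaf nice w~x dx≡1) x =
    ≤-trans (wasted-row-other w~x w~y₀ y₀≢x
              (λ y₀~x _ → ~-irrefl w~y₀ (deg≡1-unique dx≡1 (~-sym w~x) (~-sym y₀~x))))
            (≤-∑ _ y₀)

  #wasted≥3 : ∀ {w x} → w ~ x → deg G x ≢ 1 → 2 ≤ deg G w → 3 ≤ #wasted w x
  #wasted≥3 {w} {x} w~x dx≢1 2≤dw with y₀ , y₀≢x , w~y₀ ← ∃-other-neighbour 2≤dw x =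
    ≤-trans (+-mono-≤ (≤-trans 2≤dx (wasted-row-self w~x dx≢1))
                      (wasted-row-other w~x w~y₀ y₀≢x (λ _ → dx≢1)))
            (≤-∑-pair _ (y₀≢x ∘ ≡.sym))
    where
    2≤dx : 2 ≤ deg G x
    2≤dx = ≤∧≢⇒< (deg-pos (~-sym w~x)) (dx≢1 ∘ ≡.sym)

  -- The greedy construction

  module Greedy (nice : Nice G) (Δ : ℕ) (maxdeg : MaxDegreeAtMost G Δ) where

    m : ℕ
    m = Δ * Δ

    #critical≤m : ∀ z R → length (criticalPairs z R) ≤ m
    #critical≤m z R = ≤-trans (#critical≤pathCount z R) (≤-trans (pathCount≤ maxdeg z) (*-monoˡ-≤ Δ (maxdeg z)))

    saturated : ∀ {x R} → m ≤ length (criticalPairs x R) →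
                (∀ {u y} → x ~ u → u ~ y → Critical x R (u , y)) × (∀ {u} → x ~ u → deg G u ≡ Δ)
    saturated {x} {R} full = all-critical , neighbours-full
      where
      open ≤-Reasoning
      C P : Fin n → Fin n → ℕ
      C u y = 𝟙 (critical? x R (u , y))
      P u y = 𝟙 (path? x u y)
      pathCount≤#critical : pathCount x ≤ length (criticalPairs x R)
      pathCount≤#critical = ≤-trans (pathCount≤ maxdeg x) (≤-trans (*-monoˡ-≤ Δ (maxdeg x)) full)
      rows-tight : ∀ u → ∑[ y < n ] C u y ≡ ∑[ y < n ] P u y
      rows-tight = ∑-tight (λ u → ∑-mono-≤ (critical⇒path x R u)) (begin
        ∑[ u < n ] ∑[ y < n ] P u y              ≡⟨ sum-cong-≗ (paths-through x) ⟩
        pathCount x                              ≤⟨ pathCount≤#critical ⟩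
        length (criticalPairs x R)               ≡⟨ length-filter-allPairs (critical? x R) ⟩
        ∑[ u < n ] ∑[ y < n ] C u y              ∎)
      all-critical : ∀ {u y} → x ~ u → u ~ y → Critical x R (u , y)
      all-critical {u} {y} x~u u~y = 𝟙-pos (critical? x R (u , y)) (begin-strict
        0                    <⟨ z<s ⟩
        1                    ≡⟨ 𝟙-yes (path? x u y) (x~u , u~y) ⟨
        P u y                ≡⟨ ∑-tight (critical⇒path x R u) (≤-reflexive (≡.sym (rows-tight u))) y ⟨
        C u y                ∎)
      neighbours-full : ∀ {u} → x ~ u → deg G u ≡ Δ
      neighbours-full {u} x~u = begin-equality
        deg G u                     ≡⟨ *-identityˡ (deg G u) ⟨
        1 * deg G u                 ≡⟨ cong (_* deg G u) (𝟙-yes (x ~? u) x~u) ⟨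
        𝟙 (x ~? u) * deg G u        ≡⟨ ∑-tight (λ v → *-monoʳ-≤ (𝟙 (x ~? v)) (maxdeg v)) (begin
                                         ∑[ v < n ] (𝟙 (x ~? v) * Δ)  ≡⟨ ∑-neighbours x Δ ⟩
                                         deg G x * Δ                  ≤⟨ *-monoˡ-≤ Δ (maxdeg x) ⟩
                                         m                            ≤⟨ full ⟩
                                         length (criticalPairs x R)   ≤⟨ #critical≤pathCount x R ⟩
                                         pathCount x                  ∎) u ⟩
        𝟙 (x ~? u) * Δ              ≡⟨ cong (_* Δ) (𝟙-yes (x ~? u) x~u) ⟩
        1 * Δ                       ≡⟨ *-identityˡ Δ ⟩
        Δ                           ∎

    -- Pairs that never collide below m get the junk root m, which is never a candidate value.
    root : (Fin n → ℕ) → Fin n → Fin n × Fin n → ℕ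
    root ρ z p with anyUpTo? (λ s → collides? (ρ [ z ≔ s ]) p) m
    ... | yes (s , _) = s
    ... | no _        = m

    root-collides : ∀ {ρ z p} → root ρ z p < m → Collides (ρ [ z ≔ root ρ z p ]) p
    root-collides {ρ} {z} {p} r<m with anyUpTo? (λ s → collides? (ρ [ z ≔ s ]) p) m
    ... | yes (_ , _ , collides) = collides
    ... | no _                   = contradiction r<m (<-irrefl refl)

    root-unique : ∀ {ρ z u y t} → influence u z ≢ influence y z → t < m →
                  Collides (ρ [ z ≔ t ]) (u , y) → root ρ z (u , y) ≡ t
    root-unique {ρ} {z} {u} {y} {t} differ t<m collides
      with anyUpTo? (λ s → collides? (ρ [ z ≔ s ]) (u , y)) m
    ... | yes (s , _ , collides-s) = affine-root-unique differ (collision-equation collides-s) (collision-equation collides)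
    ... | no none                  = contradiction (t , t<m , collides) none

    forbidden : (Fin n → ℕ) → Fin n → List (Fin n) → List ℕ
    forbidden ρ z R = map (root ρ z) (criticalPairs z R)

    length-forbidden : ∀ ρ z R → length (forbidden ρ z R) ≡ length (criticalPairs z R)
    length-forbidden ρ z R = length-map (root ρ z) (criticalPairs z R)

    collision-forbidden : ∀ {ρ z R u y t} → Critical z R (u , y) → t < m →
                          Collides (ρ [ z ≔ t ]) (u , y) → t ∈ forbidden ρ z R
    collision-forbidden {ρ} {z} crit@(_ , _ , _ , differ) t<m collides =
      subst (_∈ _) (root-unique differ t<m collides) (∈-map⁺ (root ρ z) (∈-criticalPairs⁺ crit))

    fix-vertex : ∀ {ρ z R t} → ProperOnBalanced (z ∷ R) ρ → FreeBelow m (forbidden ρ z R) t →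
                 ProperOnBalanced R (ρ [ z ≔ t ])
    fix-vertex {ρ} {z} {R} {t} proper (t<m , t∉) {u} {y} u~y bal collides
      with influence u z ≟ influence y z
    ... | yes same  = proper u~y (same ∷ bal) (collision-balanced same collides)
    ... | no differ with unbalanced-edge-near u~y differ
    ... | inj₁ z~u = t∉ (collision-forbidden (z~u , u~y , bal , differ) t<m collides)
    ... | inj₂ z~y = t∉ (collision-forbidden (z~y , ~-sym u~y , balanced-sym bal , differ ∘ ≡.sym) t<m (≡.sym collides))

    blocked-↭ : ∀ {ρ x R} → Covers m (forbidden ρ x R) → forbidden ρ x R ↭ downFrom m
    blocked-↭ {ρ} {x} {R} =
      covers-↭-downFrom m (subst (_≤ m) (≡.sym (length-forbidden ρ x R)) (#critical≤m x R))

    blocked-root-collides : ∀ {ρ x R p} → Covers m (forbidden ρ x R) → p ∈ criticalPairs x R →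
                            Collides (ρ [ x ≔ root ρ x p ]) p
    blocked-root-collides {ρ} {x} blocked p∈ =
      root-collides (∈-downFrom⁻ (∈-resp-↭ (blocked-↭ blocked) (∈-map⁺ (root ρ x) p∈)))

    blocked-square-sum : ∀ {ρ x R} → Covers m (forbidden ρ x R) →
      sum (map (λ p → root ρ x p * root ρ x p) (criticalPairs x R)) ≡ sum (map (λ s → s * s) (downFrom m))
    blocked-square-sum {ρ} {x} {R} blocked =
      trans (cong sum (map-∘ (criticalPairs x R))) (sum-↭ (map⁺ (λ s → s * s) (blocked-↭ blocked)))

    no-three-blocked : ∀ {ρ R w x t₁ t₂ t₃} → deg G w ≢ 1 → Critical x R (w , x) → t₁ < t₂ → t₂ < t₃ →
      Covers m (forbidden (ρ [ w ≔ t₁ ]) x R) → Covers m (forbidden (ρ [ w ≔ t₂ ]) x R) →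
      Covers m (forbidden (ρ [ w ≔ t₃ ]) x R) → ⊥
    no-three-blocked {ρ} {R} {w} {x} {t₁} {t₂} {t₃} dw≢1 crit@(x~w , _) t₁<t₂ t₂<t₃
                     blocked₁ blocked₂ blocked₃ =
      <⇒≢ (<-trans t₁<t₂ t₂<t₃) t₁≡t₃
      where
      f : ℕ → Fin n × Fin n → ℕ
      f t = root (ρ [ w ≔ t ]) x
      a = t₂ ∸ t₁
      b = t₃ ∸ t₂
      t₁+a≡t₂ : t₁ + a ≡ t₂
      t₁+a≡t₂ = m+[n∸m]≡n (<⇒≤ t₁<t₂)
      t₁+a+b≡t₃ : t₁ + a + b ≡ t₃
      t₁+a+b≡t₃ = trans (cong (_+ b) t₁+a≡t₂) (m+[n∸m]≡n (<⇒≤ t₂<t₃))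
      equation : ∀ {t} → Covers m (forbidden (ρ [ w ≔ t ]) x R) →
                 ∀ {p} → p ∈ criticalPairs x R → Solves (pair-equation ρ w x p) t (f t p)
      equation blocked {_ , _} p∈ = collision-equation₂ (~-irrefl x~w) (blocked-root-collides blocked p∈)
      collinear : ∀ {p} → p ∈ criticalPairs x R → b * f t₁ p + a * f t₃ p ≡ (a + b) * f t₂ p
      collinear {p@(_ , _)} p∈ with _ , _ , _ , differ ← ∈-criticalPairs⁻ p∈ =
        solutions-collinear (pair-equation ρ w x p) differ
        (equation blocked₁ p∈)
        (subst (λ t → Solves (pair-equation ρ w x p) t (f t₂ p)) (≡.sym t₁+a≡t₂) (equation blocked₂ p∈))
        (subst (λ t → Solves (pair-equation ρ w x p) t (f t₃ p)) (≡.sym t₁+a+b≡t₃) (equation blocked₃ p∈))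
      ends-agree : f t₁ (w , x) ≡ f t₃ (w , x)
      ends-agree = equal-square-sums⇒ends-agree (criticalPairs x R) (f t₁) (f t₂) (f t₃)
        (m<n⇒0<n∸m t₁<t₂) (m<n⇒0<n∸m t₂<t₃) collinear
        (blocked-square-sum blocked₁) (blocked-square-sum blocked₂) (blocked-square-sum blocked₃)
        (∈-criticalPairs⁺ crit)
      t₁≡t₃ : t₁ ≡ t₃
      t₁≡t₃ = solutions-unique-in-t (pair-equation ρ w x (w , x))
        (λ same → dw≢1 (trans (≡.sym (influence-self w)) (trans same (influence-adjacent x~w))))
        (equation blocked₁ (∈-criticalPairs⁺ crit))
        (subst (Solves (pair-equation ρ w x (w , x)) t₃) (≡.sym ends-agree) (equation blocked₃ (∈-criticalPairs⁺ crit)))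

    free-values : ∀ {ρ R w x j} → j ≤ #wasted w x → j + length (forbidden ρ w (x ∷ R)) ≤ m
    free-values {ρ} {R} {w} {x} {j} j≤ = begin
      j + length (forbidden ρ w (x ∷ R))                ≡⟨ cong (j +_) (length-forbidden ρ w (x ∷ R)) ⟩
      j + length (criticalPairs w (x ∷ R))              ≡⟨ +-comm j _ ⟩
      length (criticalPairs w (x ∷ R)) + j              ≤⟨ +-monoʳ-≤ _ j≤ ⟩
      length (criticalPairs w (x ∷ R)) + #wasted w x    ≤⟨ #critical+#wasted≤pathCount w x R ⟩
      pathCount w                                       ≤⟨ pathCount≤ maxdeg w ⟩
      deg G w * Δ                                       ≤⟨ *-monoˡ-≤ Δ (maxdeg w) ⟩
      m                                                 ∎
      where open ≤-Reasoning

    saturated-degrees : ∀ {R w x} → w ~ x → Critical x R (w , x) → deg G w ≡ Δ → deg G x ≢ 1 × 2 ≤ deg G w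
    saturated-degrees {R} {w} {x} w~x (_ , _ , _ , differ) dw≡Δ = dx≢1 , 2≤dw
      where
      dx≢1 : deg G x ≢ 1
      dx≢1 dx≡1 = differ (trans (influence-adjacent w~x) (≡.sym (trans (influence-self x) dx≡1)))
      2≤dw : 2 ≤ deg G w
      2≤dw = subst (2 ≤_) (≡.sym dw≡Δ) (≤-trans (≤∧≢⇒< (deg-pos (~-sym w~x)) (dx≢1 ∘ ≡.sym)) (maxdeg x))

    FreeChoice : (Fin n → ℕ) → List (Fin n) → Fin n → Fin n → Set
    FreeChoice ρ R w x = ∃ λ t → ∃ λ s →
      FreeBelow m (forbidden ρ w (x ∷ R)) t × FreeBelow m (forbidden (ρ [ w ≔ t ]) x R) s

    choice-among-three : ∀ {ρ R w x t₁ t₂ t₃} → deg G w ≢ 1 → Critical x R (w , x) → t₁ < t₂ → t₂ < t₃ →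
      FreeBelow m (forbidden ρ w (x ∷ R)) t₁ → FreeBelow m (forbidden ρ w (x ∷ R)) t₂ →
      FreeBelow m (forbidden ρ w (x ∷ R)) t₃ → FreeChoice ρ R w x
    choice-among-three {ρ} {R} {w} {x} {t₁} {t₂} {t₃} dw≢1 crit t₁<t₂ t₂<t₃ free₁ free₂ free₃
      with covers-or-misses m (forbidden (ρ [ w ≔ t₁ ]) x R)
         | covers-or-misses m (forbidden (ρ [ w ≔ t₂ ]) x R)
         | covers-or-misses m (forbidden (ρ [ w ≔ t₃ ]) x R)
    ... | inj₂ (s , free) | _               | _               = t₁ , s , free₁ , free
    ... | inj₁ _          | inj₂ (s , free) | _               = t₂ , s , free₂ , free
    ... | inj₁ _          | inj₁ _          | inj₂ (s , free) = t₃ , s , free₃ , free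
    ... | inj₁ blocked₁   | inj₁ blocked₂   | inj₁ blocked₃   =
      ⊥-elim (no-three-blocked {ρ} {R} {w} {x} dw≢1 crit t₁<t₂ t₂<t₃ blocked₁ blocked₂ blocked₃)

    fix-edge-saturated : ∀ {ρ R w x} → w ~ x → Critical x R (w , x) → deg G w ≡ Δ → FreeChoice ρ R w x
    fix-edge-saturated {ρ} {R} {w} {x} w~x crit dw≡Δ =
      let dx≢1 , 2≤dw = saturated-degrees {R} w~x crit dw≡Δ
          _ , _ , _ , t₁<t₂ , t₂<t₃ , free₁ , free₂ , free₃ =
            ∃-three-free (free-values {ρ} {R} (#wasted≥3 w~x dx≢1 2≤dw))
      in choice-among-three {ρ} {R} (<⇒≢ 2≤dw ∘ ≡.sym) crit t₁<t₂ t₂<t₃ free₁ free₂ free₃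

    fix-edge : ∀ {ρ R w x} → w ~ x → FreeChoice ρ R w x
    fix-edge {ρ} {R} {w} {x} w~x with length (criticalPairs x R) <? m
    ... | yes unsaturated =
      let t , free-t = ∃-free (free-values {ρ} {R} (#wasted-pos nice w~x))
          s , free-s = ∃-free (subst (_< m) (≡.sym (length-forbidden (ρ [ w ≔ t ]) x R)) unsaturated)
      in t , s , free-t , free-s
    ... | no ¬unsaturated =
      let all-critical , neighbours-full = saturated (≮⇒≥ ¬unsaturated)
      in fix-edge-saturated w~x (all-critical (~-sym w~x) w~x) (neighbours-full (~-sym w~x))

    Bounded : (Fin n → ℕ) → Set
    Bounded ρ = ∀ v → ρ v < m

    update-bounded : ∀ {ρ z t} → Bounded ρ → t < m → Bounded (ρ [ z ≔ t ])
    update-bounded {ρ} {z} {t} bounded t<m v with v ≟ᶠ z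
    ... | yes refl = subst (_< m) (≡.sym (updateAt-updates v ρ)) t<m
    ... | no v≢z   = subst (_< m) (≡.sym (updateAt-minimal v z ρ v≢z)) (bounded v)

    fix-all : ∀ R ρ → Bounded ρ → ProperOnBalanced R ρ → ∃ λ ρ′ → Bounded ρ′ × ProperOnBalanced [] ρ′
    fix-all []      ρ bounded proper = ρ , bounded , proper
    fix-all (v ∷ R) ρ bounded proper with any? (v ~?_)
    ... | no isolated = fix-all R ρ bounded (proper-on-isolated (λ u v~u → isolated (u , v~u)) proper)
    ... | yes (x , v~x) with t , s , free-t@(t<m , _) , free-s@(s<m , _) ← fix-edge {ρ} {R} v~x =
      fix-all R (ρ [ v ≔ t ] [ x ≔ s ]) (update-bounded (update-bounded bounded t<m) s<m)
        (fix-vertex (fix-vertex (proper-on-⊆ v∷R⊆v∷x∷R proper) free-t) free-s)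
      where
      v∷R⊆v∷x∷R : v ∷ R ⊆ v ∷ x ∷ R
      v∷R⊆v∷x∷R (here v≡) = here v≡
      v∷R⊆v∷x∷R (there i) = there (there i)

<⇒≤∸1 : ∀ {a b} → a < b → a ≤ b ∸ 1
<⇒≤∸1 (s≤s a≤b) = a≤b

proposition3 : (Δ : ℕ) → 1 ≤ Δ → (n : ℕ) → (G : Graph n) →
    Nice G → MaxDegreeAtMost G Δ → P¹≤ G (Δ * Δ ∸ 1)
proposition3 Δ 1≤Δ n G nice maxdeg =
  let ρ , bounded , proper = fix-all (allFin n) (const 0) (const (*-mono-≤ 1≤Δ 1≤Δ)) (proper-on-allFin G nice (const 0))
  in ρ , proper-on-[] G proper , <⇒≤∸1 ∘ bounded
  where open Greedy G nice Δ maxdeg
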